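{- Let $\mathcal I$ be a nominal model of the simply-typed $\lambda$-calculus. Suppose $\Gamma,a{:}\phi\vdash r:\psi$ and $\Gamma\vdash s:\phi$, where $a\notin\mathrm{dom}(\Gamma)$. Then $[\![r[a:=s]]\!]_\Gamma=[\![r]\!]_{\Gamma,a:\phi}[a\mapsto[\![s]\!]_\Gamma]$, where $x[a\mapsto y]$ denotes $([a{:}\phi]x)\bullet y$.
   Context: Atoms and nominal sets: fix a countably infinite set $\mathbb A$ of atoms. A permutation is a bijection $\pi$ of $\mathbb A$ with $\{a\mid \pi(a)\neq a\}$ finite. We work in ZFA with permutation action $\pi\cdot a=\pi(a)$, $\pi\cdot X=\{\pi\cdot x\mid x\in X\}$. $A\subseteq\mathbb A$ supports $x$ if $\pi\cdot x=x$ for all $\pi$ fixing $A$ pointwise; a finitely supported $x$ has a least finite support $\mathrm{supp}(x)$; $a\#x$ means $a\notin\mathrm{supp}(x)$. Syntax: types $\phi::=\tau\mid\phi\to\phi$ over a nonempty set of base types; constants $C$ with types $\mathrm{type}(C)$; terms $r::=a\mid C\mid\lambda a{:}\phi.r\mid rr$ up to $\alpha$-equivalence; $\mathrm{fa}(r)$ free atoms; $r[a:=s]$ is capture-avoiding substitution. Type environments $\Gamma$ are functional sets of typings $a{:}\phi$; $\mathrm{dom}(\Gamma)$ its atoms; $\Gamma,a{:}\phi$ presupposes $a\notin\mathrm{dom}(\Gamma)$; $\pi\cdot\Gamma=\{\pi(a){:}\phi\mid a{:}\phi\in\Gamma\}$. Typing rules: $\Gamma,a{:}\phi\vdash a:\phi$;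 $\Gamma\vdash C:\mathrm{type}(C)$; $\Gamma,a{:}\phi\vdash r:\psi$ gives $\Gamma\vdash\lambda a{:}\phi.r:\phi\to\psi$; $\Gamma\vdash r:\phi\to\psi$ and $\Gamma\vdash s:\phi$ give $\Gamma\vdash rs:\psi$. Model: $\mathcal I$ assigns to each $\Gamma,\phi$ a finitely-supported set $\mathcal I_\Gamma(\phi)$, with elements $a^{\mathcal I}_\phi\in\mathcal I_\Gamma(\phi)$ for $a{:}\phi\in\Gamma$, $C^{\mathcal I}\in\mathcal I_\Gamma(\mathrm{type}(C))$, an abstraction $[a{:}\phi]x\in\mathcal I_\Gamma(\phi\to\psi)$ for $x\in\mathcal I_{\Gamma,a:\phi}(\psi)$, and an application $x\bullet y\in\mathcal I_\Gamma(\psi)$ for $x\in\mathcal I_\Gamma(\phi\to\psi)$, $y\in\mathcal I_\Gamma(\phi)$; such that $\mathcal I_{\Gamma\cap\Gamma'}(\phi)=\mathcal I_\Gamma(\phi)\cap\mathcal I_{\Gamma'}(\phi)$; $x\in\mathcal I_\Gamma(\phi)$ implies $\mathrm{supp}(x)\subseteq\mathrm{dom}(\Gamma)$; equivariance: $\pi\cdot\mathcal I_\Gamma(\phi)=\mathcal I_{\pi\cdot\Gamma}(\phi)$, $\pi\cdot a^{\mathcal I}_\phi=\pi(a)^{\mathcal I}_\phi$, $\pi\cdot C^{\mathcal I}=C^{\mathcal I}$, $\pi\cdot[a{:}\phi]x=[\pi(a){:}\phi]\pi\cdot x$, $\pi\cdot(x\bullet y)=(\pi\cdot x)\bullet(\pi\cdot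 y)$; and with $x[a\mapsto y]:=([a{:}\phi]x)\bullet y$: $a^{\mathcal I}_\phi[a\mapsto x]=x$; $a\#z\Rightarrow z[a\mapsto x]=z$; $(z'\bullet z)[a\mapsto x]=(z'[a\mapsto x])\bullet(z[a\mapsto x])$; $c\#x\Rightarrow([c{:}\chi]z)[a\mapsto x]=[c{:}\chi](z[a\mapsto x])$. Interpretation of $\Gamma\vdash r:\phi$: $[\![a]\!]_\Gamma=a^{\mathcal I}_\phi$ ($a{:}\phi\in\Gamma$), $[\![C]\!]_\Gamma=C^{\mathcal I}$, $[\![rs]\!]_\Gamma=[\![r]\!]_\Gamma\bullet[\![s]\!]_\Gamma$, $[\![\lambda a{:}\phi.r]\!]_\Gamma=[a{:}\phi][\![r]\!]_{\Gamma,a:\phi}$. -}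

module Defs where

open import Data.Nat using (ℕ; _≟_)
open import Data.Bool using (Bool; true; false; if_then_else_)
open import Data.List using (List; []; _∷_; _++_; map)
open import Data.List.Membership.Propositional using (_∈_; _∉_)
open import Data.List.Membership.Propositional.Properties using (∈-++⁺ˡ; ∈-++⁺ʳ)
open import Data.Product using (Σ; _×_; _,_; proj₁; proj₂)
open import Relation.Nullary using (¬_; does)
open import Relation.Binary.PropositionalEquality using (_≡_; refl; trans; cong)

Atom : Set
Atom = ℕ

record Perm : Set where
  field
    fun    : Atom → Atom
    inv    : Atom → Atom
    inv-l  : ∀ a → inv (fun a) ≡ a
    inv-r  : ∀ a → fun (inv a) ≡ a
    moved  : List Atom
    finite : ∀ a → a ∉ moved → fun a ≡ a
open Perm public

idP : Perm
idP = record { fun = λ a → a ; inv = λ a → a ; inv-l = λ _ → refl ; inv-r = λ _ → refl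
             ; moved = [] ; finite = λ _ _ → refl }

_∘P_ : Perm → Perm → Perm
π ∘P σ = record
  { fun = λ a → fun π (fun σ a)
  ; inv = λ a → inv σ (inv π a)
  ; inv-l = λ a → trans (cong (inv σ) (inv-l π (fun σ a))) (inv-l σ a)
  ; inv-r = λ a → trans (cong (fun π) (inv-r σ (inv π a))) (inv-r π a)
  ; moved = moved π ++ moved σ
  ; finite = λ a a∉ →
      trans (cong (fun π) (finite σ a (λ a∈ → a∉ (∈-++⁺ʳ (moved π) a∈))))
            (finite π a (λ a∈ → a∉ (∈-++⁺ˡ a∈)))
  }

-- The ZFA universe, abstracted as a set with a permutation action
-- (a group action of finite permutations, depending only on the
-- underlying function of the permutation).

record Universe : Set₁ where
  field
    U       : Set
    _·_     : Perm → U → U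
    act-ext : ∀ π σ → (∀ a → fun π a ≡ fun σ a) → ∀ x → π · x ≡ σ · x
    act-id  : ∀ x → idP · x ≡ x
    act-∘   : ∀ π σ x → (π ∘P σ) · x ≡ π · (σ · x)

module _ (𝕌 : Universe) where
  open Universe 𝕌

  Supports : List Atom → U → Set
  Supports A x = ∀ (π : Perm) → (∀ a → a ∈ A → fun π a ≡ a) → π · x ≡ x

  -- a # x : a is not in the least finite support of x, i.e. x has a
  -- finite support not containing a.
  Fresh : Atom → U → Set
  Fresh a x = Σ (List Atom) λ A → Supports A x × a ∉ A

data Ty (B : Set) : Set where
  base : B → Ty B
  _⇒_  : Ty B → Ty B → Ty B

infixr 20 _⇒_

record Signature : Set₁ where
  field
    BaseTy : Set
    Const  : Set
    type   : Const → Ty BaseTy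

module _ (Sig : Signature) where
  open Signature Sig

  Type : Set
  Type = Ty BaseTy

  -- Raw (named) terms; α-equivalence is given by _=α_ below.
  data Term : Set where
    var : Atom → Term
    con : Const → Term
    lam : Atom → Type → Term → Term
    app : Term → Term → Term

  -- Type environments as finite lists of typings; they are meant as
  -- functional sets (see Functional); the model only sees their
  -- underlying set (see the intersection axiom of Model).
  Env : Set
  Env = List (Atom × Type)

  dom : Env → List Atom
  dom = map proj₁

  Functional : Env → Set
  Functional Γ = ∀ a φ ψ → (a , φ) ∈ Γ → (a , ψ) ∈ Γ → φ ≡ ψ

  permEnv : Perm → Env → Env
  permEnv π = map (λ p → (fun π (proj₁ p) , proj₂ p))

  -- Typing. The context Γ , a:φ is written (a , φ) ∷ Γ and the
  -- λ-rule presupposes a ∉ dom Γ, exactly as in the paper.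
  data _⊢_∶_ : Env → Term → Type → Set where
    ⊢var : ∀ {Γ a φ} → (a , φ) ∈ Γ → Γ ⊢ var a ∶ φ
    ⊢con : ∀ {Γ} C → Γ ⊢ con C ∶ type C
    ⊢lam : ∀ {Γ a φ ψ r} → a ∉ dom Γ → ((a , φ) ∷ Γ) ⊢ r ∶ ψ → Γ ⊢ lam a φ r ∶ (φ ⇒ ψ)
    ⊢app : ∀ {Γ φ ψ r s} → Γ ⊢ r ∶ (φ ⇒ ψ) → Γ ⊢ s ∶ φ → Γ ⊢ app r s ∶ ψ

  swapA : Atom → Atom → Atom → Atom
  swapA a b c = if does (c ≟ a) then b else (if does (c ≟ b) then a else c)

  swapT : Atom → Atom → Term → Term
  swapT a b (var c)     = var (swapA a b c)
  swapT a b (con C)     = con C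
  swapT a b (lam c φ r) = lam (swapA a b c) φ (swapT a b r)
  swapT a b (app r s)   = app (swapT a b r) (swapT a b s)

  atoms : Term → List Atom
  atoms (var a)     = a ∷ []
  atoms (con C)     = []
  atoms (lam a φ r) = a ∷ atoms r
  atoms (app r s)   = atoms r ++ atoms s

  data _=α_ : Term → Term → Set where
    α-var : ∀ a → var a =α var a
    α-con : ∀ C → con C =α con C
    α-app : ∀ {r r′ s s′} → r =α r′ → s =α s′ → app r s =α app r′ s′
    α-lam : ∀ {a b φ r s} c → c ∉ (a ∷ b ∷ atoms r ++ atoms s) →
            swapT a c r =α swapT b c s → lam a φ r =α lam b φ s

  -- It does not rename binders; it is used only for
  -- r typed in Γ , a:φ (whose binders avoid dom Γ ∪ {a}) and s typed in Γ
  -- (so fa(s) ⊆ dom Γ), where it is capture-avoiding.  The statement then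
  -- considers every term α-equivalent to it.
  subst : Term → Atom → Term → Term
  subst (var b)     a s = if does (a ≟ b) then s else var b
  subst (con C)     a s = con C
  subst (lam b φ r) a s = if does (a ≟ b) then lam b φ r else lam b φ (subst r a s)
  subst (app r r′)  a s = app (subst r a s) (subst r′ a s)

module _ (Sig : Signature) (𝕌 : Universe) where
  open Signature Sig
  open Universe 𝕌

  record Model : Set₁ where
    field
      I    : Env Sig → Type Sig → U → Set
      vr   : Atom → Type Sig → U
      cn   : Const → U
      abs  : Atom → Type Sig → U → U
      ap   : U → U → U

      vr-∈  : ∀ {Γ a φ} → Functional Sig Γ → (a , φ) ∈ Γ → I Γ φ (vr a φ)
      cn-∈  : ∀ {Γ} C → Functional Sig Γ → I Γ (type C) (cn C)
      abs-∈ : ∀ {Γ a φ ψ x} → Functional Sig Γ → a ∉ dom Sig Γ →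
              I ((a , φ) ∷ Γ) ψ x → I Γ (φ ⇒ ψ) (abs a φ x)
      ap-∈  : ∀ {Γ φ ψ x y} → Functional Sig Γ →
              I Γ (φ ⇒ ψ) x → I Γ φ y → I Γ ψ (ap x y)

      -- 𝓘_{Γ∩Γ'}(φ) = 𝓘_Γ(φ) ∩ 𝓘_{Γ'}(φ), where Δ is any list with
      -- underlying set Γ ∩ Γ'.
      inter : ∀ {Γ Γ′ Δ} → Functional Sig Γ → Functional Sig Γ′ →
              (∀ t → (t ∈ Δ → t ∈ Γ × t ∈ Γ′) × (t ∈ Γ × t ∈ Γ′ → t ∈ Δ)) →
              ∀ φ x → (I Δ φ x → I Γ φ x × I Γ′ φ x) × (I Γ φ x × I Γ′ φ x → I Δ φ x)

      supp-⊆ : ∀ {Γ φ x} → Functional Sig Γ → I Γ φ x → Supports 𝕌 (dom Sig Γ) x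

      eqv-I   : ∀ {Γ} π φ → Functional Sig Γ →
                (∀ x → I Γ φ x → I (permEnv Sig π Γ) φ (π · x)) ×
                (∀ y → I (permEnv Sig π Γ) φ y → Σ U λ x → I Γ φ x × π · x ≡ y)
      eqv-vr  : ∀ π a φ → π · vr a φ ≡ vr (fun π a) φ
      eqv-cn  : ∀ π C → π · cn C ≡ cn C
      eqv-abs : ∀ {Γ a φ ψ x} π → Functional Sig Γ → a ∉ dom Sig Γ →
                I ((a , φ) ∷ Γ) ψ x → π · abs a φ x ≡ abs (fun π a) φ (π · x)
      eqv-ap  : ∀ {Γ φ ψ x y} π → Functional Sig Γ →
                I Γ (φ ⇒ ψ) x → I Γ φ y → π · ap x y ≡ ap (π · x) (π · y)

      -- substitution laws, with z[a ↦ x] := ([a:φ]z) • x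
      β-var   : ∀ {Γ a φ x} → Functional Sig Γ → a ∉ dom Sig Γ → I Γ φ x →
                ap (abs a φ (vr a φ)) x ≡ x
      β-fresh : ∀ {Γ a φ ψ x z} → Functional Sig Γ → a ∉ dom Sig Γ →
                I ((a , φ) ∷ Γ) ψ z → I Γ φ x → Fresh 𝕌 a z →
                ap (abs a φ z) x ≡ z
      β-app   : ∀ {Γ a φ χ ψ x z′ z} → Functional Sig Γ → a ∉ dom Sig Γ →
                I ((a , φ) ∷ Γ) (χ ⇒ ψ) z′ → I ((a , φ) ∷ Γ) χ z → I Γ φ x →
                ap (abs a φ (ap z′ z)) x ≡ ap (ap (abs a φ z′) x) (ap (abs a φ z) x)
      β-lam   : ∀ {Γ a φ c χ ψ x z} → Functional Sig Γ → a ∉ dom Sig Γ →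
                c ∉ dom Sig Γ → ¬ (c ≡ a) →
                I ((a , φ) ∷ (c , χ) ∷ Γ) ψ z → I ((c , χ) ∷ Γ) φ x → Fresh 𝕌 c x →
                ap (abs a φ (abs c χ z)) x ≡ abs c χ (ap (abs a φ z) x)

  ⟦_⟧ : ∀ (M : Model) {Γ r φ} → _⊢_∶_ Sig Γ r φ → U
  ⟦ M ⟧ (⊢var {a = a} {φ = φ} _) = Model.vr M a φ
  ⟦ M ⟧ (⊢con C)                 = Model.cn M C
  ⟦ M ⟧ (⊢lam {a = a} {φ = φ} _ D) = Model.abs M a φ (⟦ M ⟧ D)
  ⟦ M ⟧ (⊢app D E)               = Model.ap M (⟦ M ⟧ D) (⟦ M ⟧ E)

module Submission where

-- Retyping terms in other environments is blocked by the λ-rule (binders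
-- fresh for the whole environment), so `Semantics` works with a relaxed
-- judgement ⊢s whose λ-rule types the body over any sub-environment; ordinary
-- derivations embed into it with the same value.  Relaxed derivations can be
-- transported between environments agreeing on the atoms of the term and
-- swapped by a transposition (equivariance).  With the support axiom this
-- gives [a:φ]x = [c:φ]((a c)·x), hence α-invariance of the denotation.
-- Independently, induction on the derivation of r and the substitution laws
-- of the model build a derivation of r[a:=s] with value ⟦r⟧[a ↦ ⟦s⟧].

open import Defs
open import Data.Empty using (⊥-elim)
open import Data.List using (List; []; _∷_; filter)
open import Data.List.Membership.Propositional using (_∈_; _∉_)
open import Data.List.Membership.Propositional.Properties
  using (∈-map⁺; ∈-map⁻; ∈-++⁺ˡ; ∈-++⁺ʳ; ∈-filter⁺; ∈-filter⁻)
open import Data.List.Relation.Binary.Subset.Propositional using (_⊆_)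
open import Data.List.Relation.Binary.Subset.Propositional.Properties using (map⁺)
open import Data.List.Relation.Unary.Any using (here; there)
open import Data.Nat using (_≟_)
open import Data.Product using (Σ; _,_; proj₁; proj₂)
open import Relation.Nullary using (¬_; ¬?; yes; no)
open import Relation.Nullary.Decidable using (dec-true; dec-false)
open import Relation.Binary.PropositionalEquality
  using (_≡_; refl; sym; trans; cong; cong₂; module ≡-Reasoning)
import Relation.Binary.PropositionalEquality as ≡

module Transpositions (Sig : Signature) where

  swap : Atom → Atom → Atom → Atom
  swap = swapA Sig

  swap-left : ∀ a c → swap a c a ≡ c
  swap-left a c rewrite dec-true (a ≟ a) refl = refl

  swap-other : ∀ {a c x} → ¬ x ≡ a → ¬ x ≡ c → swap a c x ≡ x
  swap-other {a} {c} {x} x≢a x≢c rewrite dec-false (x ≟ a) x≢a | dec-false (x ≟ c) x≢c = refl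

  swap-right : ∀ a c → swap a c c ≡ a
  swap-right a c with c ≟ a
  ... | yes refl = swap-left c c
  ... | no c≢a rewrite dec-false (c ≟ a) c≢a | dec-true (c ≟ c) refl = refl

  swap-involutive : ∀ a c x → swap a c (swap a c x) ≡ x
  swap-involutive a c x with x ≟ a | x ≟ c
  ... | yes refl | _ rewrite swap-left x c = swap-right x c
  ... | no _ | yes refl rewrite swap-right a x = swap-left a x
  ... | no x≢a | no x≢c rewrite swap-other {a} {c} x≢a x≢c = swap-other x≢a x≢c

  transposition : Atom → Atom → Perm
  transposition a c = record
    { fun = swap a c ; inv = swap a c
    ; inv-l = swap-involutive a c ; inv-r = swap-involutive a c
    ; moved = a ∷ c ∷ []
    ; finite = λ x x∉ → swap-other (λ x≡a → x∉ (here x≡a)) (λ x≡c → x∉ (there (here x≡c)))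
    }

module Environments (Sig : Signature) where
  open Transpositions Sig

  dom-∈ : ∀ {Γ : Env Sig} {x φ} → (x , φ) ∈ Γ → x ∈ dom Sig Γ
  dom-∈ = ∈-map⁺ proj₁

  dom-⊆ : ∀ {Γ Δ : Env Sig} → Γ ⊆ Δ → dom Sig Γ ⊆ dom Sig Δ
  dom-⊆ = map⁺ proj₁

  functional-⊆ : ∀ {Γ Δ} → Functional Sig Γ → Δ ⊆ Γ → Functional Sig Δ
  functional-⊆ F Δ⊆Γ x φ ψ m m′ = F x φ ψ (Δ⊆Γ m) (Δ⊆Γ m′)

  functional-∷ : ∀ {Γ a φ} → Functional Sig Γ → a ∉ dom Sig Γ → Functional Sig ((a , φ) ∷ Γ)
  functional-∷ F a∉ x φ ψ (here refl) (here refl) = refl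
  functional-∷ F a∉ x φ ψ (here refl) (there m′)  = ⊥-elim (a∉ (dom-∈ m′))
  functional-∷ F a∉ x φ ψ (there m)   (here refl) = ⊥-elim (a∉ (dom-∈ m))
  functional-∷ F a∉ x φ ψ (there m)   (there m′)  = F x φ ψ m m′

  extend-⊆ : ∀ {A : Set} {Δ Γ : List A} {p q} → Δ ⊆ p ∷ Γ → q ∷ Δ ⊆ p ∷ q ∷ Γ
  extend-⊆ Δ⊆ (here refl) = there (here refl)
  extend-⊆ Δ⊆ (there m) with Δ⊆ m
  ... | here e   = here e
  ... | there m′ = there (there m′)

  extend-⊇ : ∀ {A : Set} {Δ Γ : List A} {p q} → p ∷ Γ ⊆ Δ → p ∷ q ∷ Γ ⊆ q ∷ Δ
  extend-⊇ ⊆Δ (here e)          = there (⊆Δ (here e))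
  extend-⊇ ⊆Δ (there (here e))  = here e
  extend-⊇ ⊆Δ (there (there m)) = there (⊆Δ (there m))

  remove : Atom → Env Sig → Env Sig
  remove b = filter (λ p → ¬? (proj₁ p ≟ b))

  remove-⊆ : ∀ b Γ → remove b Γ ⊆ Γ
  remove-⊆ b Γ m = proj₁ (∈-filter⁻ (λ p → ¬? (proj₁ p ≟ b)) m)

  remove-∉ : ∀ b Γ → b ∉ dom Sig (remove b Γ)
  remove-∉ b Γ m with ∈-map⁻ proj₁ m
  ... | p , p∈ , refl = proj₂ (∈-filter⁻ (λ p → ¬? (proj₁ p ≟ b)) {xs = Γ} p∈) refl

  remove-∈ : ∀ b Γ {x φ} → (x , φ) ∈ Γ → ¬ x ≡ b → (x , φ) ∈ remove b Γ
  remove-∈ b Γ m x≢b = ∈-filter⁺ (λ p → ¬? (proj₁ p ≟ b)) m x≢b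

  swapEnv : Atom → Atom → Env Sig → Env Sig
  swapEnv a c = permEnv Sig (transposition a c)

  swapEnv-∈ : ∀ {a c Γ x φ} → (x , φ) ∈ Γ → (swap a c x , φ) ∈ swapEnv a c Γ
  swapEnv-∈ {a} {c} = ∈-map⁺ (λ p → (swap a c (proj₁ p) , proj₂ p))

  swapEnv-∈⁻ : ∀ {a c Γ x φ} → (x , φ) ∈ swapEnv a c Γ → (swap a c x , φ) ∈ Γ
  swapEnv-∈⁻ {a} {c} m with ∈-map⁻ (λ p → (swap a c (proj₁ p) , proj₂ p)) m
  ... | (y , ψ) , m′ , refl rewrite swap-involutive a c y = m′

  swapEnv-⊆ : ∀ {a c Γ Δ} → Γ ⊆ Δ → swapEnv a c Γ ⊆ swapEnv a c Δ
  swapEnv-⊆ {a} {c} Γ⊆Δ {x , φ} m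
    with swapEnv-∈ {a} {c} (Γ⊆Δ (swapEnv-∈⁻ {a} {c} m))
  ... | m′ rewrite swap-involutive a c x = m′

  swapEnv-∉ : ∀ {a c Γ b} → b ∉ dom Sig Γ → swap a c b ∉ dom Sig (swapEnv a c Γ)
  swapEnv-∉ {a} {c} {Γ} {b} b∉ m with ∈-map⁻ proj₁ m
  ... | (y , φ) , m′ , e with swapEnv-∈⁻ {a} {c} m′
  ... | m″ rewrite sym e | swap-involutive a c b = b∉ (dom-∈ m″)

  swapEnv-fresh : ∀ {a c Γ x φ} → a ∉ dom Sig Γ → c ∉ dom Sig Γ →
    (x , φ) ∈ swapEnv a c Γ → (x , φ) ∈ Γ
  swapEnv-fresh {a} {c} {Γ} {x} {φ} a∉ c∉ m =
    ≡.subst (λ y → (y , φ) ∈ Γ) (trans (sym fixed) (swap-involutive a c x)) m′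
    where
    m′ : (swap a c x , φ) ∈ Γ
    m′ = swapEnv-∈⁻ {a} {c} m
    fixed : swap a c (swap a c x) ≡ swap a c x
    fixed = swap-other (λ e → a∉ (≡.subst (_∈ dom Sig Γ) e (dom-∈ m′)))
                       (λ e → c∉ (≡.subst (_∈ dom Sig Γ) e (dom-∈ m′)))

module Semantics (Sig : Signature) (𝕌 : Universe) (M : Model Sig 𝕌) where
  open Signature Sig using (type)
  open Universe 𝕌
  open Model M
  open Transpositions Sig
  open Environments Sig

  _[_∶_↦_] : U → Atom → Type Sig → U → U
  x [ a ∶ φ ↦ y ] = ap (abs a φ x) y

  -- Monotonicity of 𝓘 in the environment, from the intersection axiom
  -- applied to Γ ∩ Δ = Δ.
  I-mono : ∀ {Γ Δ φ x} → Functional Sig Γ → Functional Sig Δ → Δ ⊆ Γ → I Δ φ x → I Γ φ x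
  I-mono {Γ} {Δ} {φ} {x} FΓ FΔ Δ⊆Γ i =
    proj₁ (proj₁ (inter {Γ} {Δ} {Δ} FΓ FΔ (λ t → (λ m → Δ⊆Γ m , m) , proj₂) φ x) i)

  fresh-outside : ∀ {Γ a φ x} → Functional Sig Γ → a ∉ dom Sig Γ → I Γ φ x → Fresh 𝕌 a x
  fresh-outside {Γ} F a∉ i = dom Sig Γ , supp-⊆ F i , a∉

  -- Renaming the bound atom of an abstraction: for a, c outside Δ,
  -- [a:φ]x = [c:φ]((a c)·x), because (a c) fixes [a:φ]x, which is supported by Δ.
  abs-rename : ∀ {Δ a c φ ψ x} → Functional Sig Δ → a ∉ dom Sig Δ → c ∉ dom Sig Δ →
    I ((a , φ) ∷ Δ) ψ x → abs a φ x ≡ abs c φ (transposition a c · x)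
  abs-rename {Δ} {a} {c} {φ} {x = x} F a∉ c∉ i = begin
    abs a φ x                                     ≡⟨ sym fixed ⟩
    transposition a c · abs a φ x                 ≡⟨ eqv-abs (transposition a c) F a∉ i ⟩
    abs (swap a c a) φ (transposition a c · x)    ≡⟨ cong (λ b → abs b φ (transposition a c · x)) (swap-left a c) ⟩
    abs c φ (transposition a c · x)               ∎
    where
    open ≡-Reasoning
    fixed : transposition a c · abs a φ x ≡ abs a φ x
    fixed = supp-⊆ F (abs-∈ F a∉ i) (transposition a c)
              (λ y y∈ → swap-other (λ { refl → a∉ y∈ }) (λ { refl → c∉ y∈ }))

  data _⊢s_∶_ : Env Sig → Term Sig → Type Sig → Set where
    svar : ∀ {Γ a φ} → (a , φ) ∈ Γ → Γ ⊢s var a ∶ φ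
    scon : ∀ {Γ} C → Γ ⊢s con C ∶ type C
    slam : ∀ {Γ Γ₀ a φ ψ r} → Γ₀ ⊆ Γ → a ∉ dom Sig Γ₀ → ((a , φ) ∷ Γ₀) ⊢s r ∶ ψ →
           Γ ⊢s lam a φ r ∶ (φ ⇒ ψ)
    sapp : ∀ {Γ φ ψ r s} → Γ ⊢s r ∶ (φ ⇒ ψ) → Γ ⊢s s ∶ φ → Γ ⊢s app r s ∶ ψ

  ⟦_⟧s : ∀ {Γ r φ} → Γ ⊢s r ∶ φ → U
  ⟦ svar {a = a} {φ = φ} _ ⟧s     = vr a φ
  ⟦ scon C ⟧s                     = cn C
  ⟦ slam {a = a} {φ = φ} _ _ D ⟧s = abs a φ ⟦ D ⟧s
  ⟦ sapp D E ⟧s                   = ap ⟦ D ⟧s ⟦ E ⟧s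

  ⟦_⟧⊢ : ∀ {Γ r φ} → _⊢_∶_ Sig Γ r φ → U
  ⟦ D ⟧⊢ = ⟦_⟧ Sig 𝕌 M D

  embed : ∀ {Γ r φ} → _⊢_∶_ Sig Γ r φ → Γ ⊢s r ∶ φ
  embed (⊢var m)     = svar m
  embed (⊢con C)     = scon C
  embed (⊢lam a∉ D)  = slam (λ m → m) a∉ (embed D)
  embed (⊢app D E)   = sapp (embed D) (embed E)

  embed-⟦⟧ : ∀ {Γ r φ} (D : _⊢_∶_ Sig Γ r φ) → ⟦ embed D ⟧s ≡ ⟦ D ⟧⊢
  embed-⟦⟧ (⊢var m)                    = refl
  embed-⟦⟧ (⊢con C)                    = refl
  embed-⟦⟧ (⊢lam {a = a} {φ = φ} _ D)  = cong (abs a φ) (embed-⟦⟧ D)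
  embed-⟦⟧ (⊢app D E)                  = cong₂ ap (embed-⟦⟧ D) (embed-⟦⟧ E)

  sound : ∀ {Γ r φ} → Functional Sig Γ → (D : Γ ⊢s r ∶ φ) → I Γ φ ⟦ D ⟧s
  sound F (svar m)          = vr-∈ F m
  sound F (scon C)          = cn-∈ C F
  sound F (slam {Γ₀ = Γ₀} Γ₀⊆Γ a∉ D) = I-mono F F₀ Γ₀⊆Γ (abs-∈ F₀ a∉ (sound (functional-∷ F₀ a∉) D))
    where
    F₀ : Functional Sig Γ₀
    F₀ = functional-⊆ F Γ₀⊆Γ
  sound F (sapp D E)        = ap-∈ F (sound F D) (sound F E)

  sound⊢ : ∀ {Γ r φ} → Functional Sig Γ → (D : _⊢_∶_ Sig Γ r φ) → I Γ φ ⟦ D ⟧⊢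
  sound⊢ {Γ} {φ = φ} F D = ≡.subst (I Γ φ) (embed-⟦⟧ D) (sound F (embed D))

  transport : ∀ {Δ Δ′ r ψ} (D : Δ ⊢s r ∶ ψ) →
    (∀ {x φ} → x ∈ atoms Sig r → (x , φ) ∈ Δ → (x , φ) ∈ Δ′) →
    Σ (Δ′ ⊢s r ∶ ψ) λ D′ → ⟦ D′ ⟧s ≡ ⟦ D ⟧s
  transport (svar m) keep = svar (keep (here refl) m) , refl
  transport (scon C) keep = scon C , refl
  transport {Δ′ = Δ′} (slam {Γ₀ = Γ₀} {a = b} {φ = χ} {ψ} {r} Γ₀⊆Δ b∉ D) keep =
    slam (remove-⊆ b Δ′) (remove-∉ b Δ′) (proj₁ body) , cong (abs b χ) (proj₂ body)
    where
    -- the binder b shadows any typing of b in Δ′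
    keep-body : ∀ {x φ} → x ∈ atoms Sig r → (x , φ) ∈ (b , χ) ∷ Γ₀ → (x , φ) ∈ (b , χ) ∷ remove b Δ′
    keep-body x∈ (here e)  = here e
    keep-body x∈ (there m) = there (remove-∈ b Δ′ (keep (there x∈) (Γ₀⊆Δ m)) (λ { refl → b∉ (dom-∈ m) }))
    body : Σ (((b , χ) ∷ remove b Δ′) ⊢s r ∶ ψ) λ D′ → ⟦ D′ ⟧s ≡ ⟦ D ⟧s
    body = transport D keep-body
  transport (sapp {r = r} D E) keep
    with transport D (λ x∈ → keep (∈-++⁺ˡ x∈)) | transport E (λ x∈ → keep (∈-++⁺ʳ (atoms Sig r) x∈))
  ... | D′ , e | E′ , e′ = sapp D′ E′ , cong₂ ap e e′

  weaken : ∀ {Δ Δ′ r ψ} → Δ ⊆ Δ′ → (D : Δ ⊢s r ∶ ψ) → Σ (Δ′ ⊢s r ∶ ψ) λ D′ → ⟦ D′ ⟧s ≡ ⟦ D ⟧s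
  weaken Δ⊆Δ′ D = transport D (λ _ m → Δ⊆Δ′ m)

  swap-derivation : ∀ a c {Δ r ψ} → Functional Sig Δ → (D : Δ ⊢s r ∶ ψ) →
    Σ (swapEnv a c Δ ⊢s swapT Sig a c r ∶ ψ) λ D′ → ⟦ D′ ⟧s ≡ transposition a c · ⟦ D ⟧s
  swap-derivation a c F (svar {a = x} {φ = φ} m) =
    svar (swapEnv-∈ {a} {c} m) , sym (eqv-vr (transposition a c) x φ)
  swap-derivation a c F (scon C) = scon C , sym (eqv-cn (transposition a c) C)
  swap-derivation a c F (slam {Γ₀ = Γ₀} {a = b} {φ = χ} {ψ} {r} Γ₀⊆Γ b∉ D) =
    slam (swapEnv-⊆ {a} {c} Γ₀⊆Γ) (swapEnv-∉ {a} {c} {Γ₀} b∉) (proj₁ body) ,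
    trans (cong (abs (swap a c b) χ) (proj₂ body))
          (sym (eqv-abs (transposition a c) F₀ b∉ (sound (functional-∷ F₀ b∉) D)))
    where
    F₀ : Functional Sig Γ₀
    F₀ = functional-⊆ F Γ₀⊆Γ
    body : Σ (swapEnv a c ((b , χ) ∷ Γ₀) ⊢s swapT Sig a c r ∶ ψ) λ D′ → ⟦ D′ ⟧s ≡ transposition a c · ⟦ D ⟧s
    body = swap-derivation a c (functional-∷ F₀ b∉) D
  swap-derivation a c F (sapp D E) with swap-derivation a c F D | swap-derivation a c F E
  ... | D′ , e | E′ , e′ =
    sapp D′ E′ , trans (cong₂ ap e e′) (sym (eqv-ap (transposition a c) F (sound F D) (sound F E)))

  rename-binder : ∀ {Γ Γ₀ a c φ ψ r} → Functional Sig Γ → Γ₀ ⊆ Γ → a ∉ dom Sig Γ₀ →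
    c ∉ atoms Sig r → (D : ((a , φ) ∷ Γ₀) ⊢s r ∶ ψ) →
    Σ (((c , φ) ∷ remove c Γ) ⊢s swapT Sig a c r ∶ ψ) λ D′ → abs a φ ⟦ D ⟧s ≡ abs c φ ⟦ D′ ⟧s
  rename-binder {Γ} {Γ₀} {a} {c} {φ} {ψ} {r} F Γ₀⊆Γ a∉Γ₀ c∉r D = proj₁ renamed , (begin
    abs a φ ⟦ D ⟧s                                   ≡⟨ cong (abs a φ) (sym (proj₂ body)) ⟩
    abs a φ ⟦ proj₁ body ⟧s                          ≡⟨ abs-rename F₁ a∉Γ₁ c∉Γ₁ (sound F₁′ (proj₁ body)) ⟩
    abs c φ (transposition a c · ⟦ proj₁ body ⟧s)    ≡⟨ cong (abs c φ) (sym (proj₂ swapped)) ⟩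
    abs c φ ⟦ proj₁ swapped ⟧s                       ≡⟨ cong (abs c φ) (sym (proj₂ renamed)) ⟩
    abs c φ ⟦ proj₁ renamed ⟧s                       ∎)
    where
    open ≡-Reasoning
    -- Γ without a and c: the environment in which the swap fixes everything.
    Γ₁ : Env Sig
    Γ₁ = remove a (remove c Γ)
    Γ₁⊆Γ : Γ₁ ⊆ Γ
    Γ₁⊆Γ m = remove-⊆ c Γ (remove-⊆ a (remove c Γ) m)
    a∉Γ₁ : a ∉ dom Sig Γ₁
    a∉Γ₁ = remove-∉ a (remove c Γ)
    c∉Γ₁ : c ∉ dom Sig Γ₁
    c∉Γ₁ m = remove-∉ c Γ (dom-⊆ (remove-⊆ a (remove c Γ)) m)
    F₁ : Functional Sig Γ₁
    F₁ = functional-⊆ F Γ₁⊆Γ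
    F₁′ : Functional Sig ((a , φ) ∷ Γ₁)
    F₁′ = functional-∷ F₁ a∉Γ₁
    keep : ∀ {x θ} → x ∈ atoms Sig r → (x , θ) ∈ (a , φ) ∷ Γ₀ → (x , θ) ∈ (a , φ) ∷ Γ₁
    keep x∈ (here e)  = here e
    keep x∈ (there m) = there (remove-∈ a (remove c Γ)
                                 (remove-∈ c Γ (Γ₀⊆Γ m) (λ { refl → c∉r x∈ }))
                                 (λ { refl → a∉Γ₀ (dom-∈ m) }))
    back : swapEnv a c ((a , φ) ∷ Γ₁) ⊆ (c , φ) ∷ remove c Γ
    back (here e)  = here (trans e (cong (_, φ) (swap-left a c)))
    back (there m) = there (remove-⊆ a (remove c Γ) (swapEnv-fresh a∉Γ₁ c∉Γ₁ m))
    body : Σ (((a , φ) ∷ Γ₁) ⊢s r ∶ ψ) λ D₁ → ⟦ D₁ ⟧s ≡ ⟦ D ⟧s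
    body = transport D keep
    swapped : Σ (swapEnv a c ((a , φ) ∷ Γ₁) ⊢s swapT Sig a c r ∶ ψ) λ D₂ →
                ⟦ D₂ ⟧s ≡ transposition a c · ⟦ proj₁ body ⟧s
    swapped = swap-derivation a c F₁′ (proj₁ body)
    renamed : Σ (((c , φ) ∷ remove c Γ) ⊢s swapT Sig a c r ∶ ψ) λ D₃ → ⟦ D₃ ⟧s ≡ ⟦ proj₁ swapped ⟧s
    renamed = weaken back (proj₁ swapped)

  α-invariant : ∀ {Γ t u ψ ψ′} → Functional Sig Γ → _=α_ Sig t u →
    (D : Γ ⊢s t ∶ ψ) (E : Γ ⊢s u ∶ ψ′) → ⟦ D ⟧s ≡ ⟦ E ⟧s
  α-invariant F (α-var a) (svar m) (svar m′) = cong (vr a) (F a _ _ m m′)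
  α-invariant F (α-con C) (scon _) (scon _) = refl
  α-invariant F (α-app t=u t′=u′) (sapp D D′) (sapp E E′) =
    cong₂ ap (α-invariant F t=u D E) (α-invariant F t′=u′ D′ E′)
  α-invariant {Γ} F (α-lam {φ = φ} {r = r} c c∉ r=s) (slam Γ₀⊆Γ a∉ D) (slam Δ₀⊆Γ b∉ E)
    with rename-binder F Γ₀⊆Γ a∉ (λ x∈ → c∉ (there (there (∈-++⁺ˡ x∈)))) D
       | rename-binder F Δ₀⊆Γ b∉ (λ x∈ → c∉ (there (there (∈-++⁺ʳ (atoms Sig r) x∈)))) E
  ... | D′ , eD | E′ , eE =
    trans eD (trans (cong (abs c φ) (α-invariant F′ r=s D′ E′)) (sym eE))
    where
    F′ : Functional Sig ((c , φ) ∷ remove c Γ)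
    F′ = functional-∷ (functional-⊆ F (remove-⊆ c Γ)) (remove-∉ c Γ)

  sound-extended : ∀ {Γ Δ a φ ψ r} → Functional Sig Γ → a ∉ dom Sig Γ → Δ ⊆ (a , φ) ∷ Γ →
    (D : _⊢_∶_ Sig Δ r ψ) → I ((a , φ) ∷ Γ) ψ ⟦ D ⟧⊢
  sound-extended {Γ} {Δ} {a} {φ} F a∉ Δ⊆ D = I-mono F′ FΔ Δ⊆ (sound⊢ FΔ D)
    where
    F′ : Functional Sig ((a , φ) ∷ Γ)
    F′ = functional-∷ F a∉
    FΔ : Functional Sig Δ
    FΔ = functional-⊆ F′ Δ⊆

  substitution-var : ∀ {Γ a b φ ψ s} → Functional Sig Γ → a ∉ dom Sig Γ →
    (b , ψ) ∈ (a , φ) ∷ Γ → (E : Γ ⊢s s ∶ φ) →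
    Σ (Γ ⊢s subst Sig (var b) a s ∶ ψ) λ G → ⟦ G ⟧s ≡ vr b ψ [ a ∶ φ ↦ ⟦ E ⟧s ]
  substitution-var {a = a} F a∉ (here refl) E rewrite dec-true (a ≟ a) refl =
    E , sym (β-var F a∉ (sound F E))
  substitution-var {a = a} {b} F a∉ (there m) E rewrite dec-false (a ≟ b) (λ { refl → a∉ (dom-∈ m) }) =
    svar m , sym (β-fresh F a∉ (vr-∈ (functional-∷ F a∉) (there m)) (sound F E)
                          (fresh-outside F a∉ (vr-∈ F m)))

  -- Substitution under a binder b ∉ Γ distinct from a: since b ≠ a the
  -- substitution enters the body, and since b is fresh for ⟦s⟧ the law for
  -- abstractions moves [a ↦ ⟦s⟧] inside [b:χ].
  substitution-lam : ∀ {Γ a b φ χ ψ r s z} → Functional Sig Γ → a ∉ dom Sig Γ →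
    b ∉ dom Sig Γ → ¬ b ≡ a → I ((a , φ) ∷ (b , χ) ∷ Γ) ψ z →
    (E : Γ ⊢s s ∶ φ) (E′ : ((b , χ) ∷ Γ) ⊢s s ∶ φ) → ⟦ E′ ⟧s ≡ ⟦ E ⟧s →
    Σ (((b , χ) ∷ Γ) ⊢s subst Sig r a s ∶ ψ) (λ G → ⟦ G ⟧s ≡ z [ a ∶ φ ↦ ⟦ E′ ⟧s ]) →
    Σ (Γ ⊢s subst Sig (lam b χ r) a s ∶ (χ ⇒ ψ)) λ G → ⟦ G ⟧s ≡ abs b χ z [ a ∶ φ ↦ ⟦ E ⟧s ]
  substitution-lam {Γ} {a} {b} {φ} {χ} {z = z} F a∉ b∉ b≢a iz E E′ eE (G , eG)
    rewrite dec-false (a ≟ b) (λ a≡b → b≢a (sym a≡b)) =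
    slam (λ m → m) b∉ G , (begin
      abs b χ ⟦ G ⟧s                  ≡⟨ cong (abs b χ) (trans eG (cong (λ x → z [ a ∶ φ ↦ x ]) eE)) ⟩
      abs b χ (z [ a ∶ φ ↦ ⟦ E ⟧s ])  ≡⟨ sym (β-lam F a∉ b∉ b≢a iz ix (fresh-outside F b∉ (sound F E))) ⟩
      abs b χ z [ a ∶ φ ↦ ⟦ E ⟧s ]    ∎)
    where
    open ≡-Reasoning
    ix : I ((b , χ) ∷ Γ) φ ⟦ E ⟧s
    ix = I-mono (functional-∷ F b∉) F there (sound F E)

  -- The environment Δ of r is only
  -- required to have the underlying set of Γ , a:φ, so that the induction can
  -- pass under binders.
  substitution : ∀ {Γ Δ a φ ψ r s} → Functional Sig Γ → a ∉ dom Sig Γ →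
    Δ ⊆ (a , φ) ∷ Γ → (a , φ) ∷ Γ ⊆ Δ → (D : _⊢_∶_ Sig Δ r ψ) (E : Γ ⊢s s ∶ φ) →
    Σ (Γ ⊢s subst Sig r a s ∶ ψ) λ G → ⟦ G ⟧s ≡ ⟦ D ⟧⊢ [ a ∶ φ ↦ ⟦ E ⟧s ]
  substitution F a∉ Δ⊆ ⊆Δ (⊢var m) E = substitution-var F a∉ (Δ⊆ m) E
  substitution F a∉ Δ⊆ ⊆Δ (⊢con C) E =
    scon C , sym (β-fresh F a∉ (cn-∈ C (functional-∷ F a∉)) (sound F E) (fresh-outside F a∉ (cn-∈ C F)))
  substitution F a∉ Δ⊆ ⊆Δ (⊢app D₁ D₂) E
    with substitution F a∉ Δ⊆ ⊆Δ D₁ E | substitution F a∉ Δ⊆ ⊆Δ D₂ E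
  ... | G₁ , e₁ | G₂ , e₂ =
    sapp G₁ G₂ , trans (cong₂ ap e₁ e₂)
      (sym (β-app F a∉ (sound-extended F a∉ Δ⊆ D₁) (sound-extended F a∉ Δ⊆ D₂) (sound F E)))
  substitution {Γ} {a = a} {φ} {s = s} F a∉ Δ⊆ ⊆Δ (⊢lam {a = b} {φ = χ} b∉Δ D) E
    =
    substitution-lam F a∉ b∉Γ b≢a (sound-extended F′ a∉′ (extend-⊆ Δ⊆) D) E (proj₁ E′) (proj₂ E′)
      (substitution F′ a∉′ (extend-⊆ Δ⊆) (extend-⊇ ⊆Δ) D (proj₁ E′))
    where
    b∉Γ : b ∉ dom Sig Γ
    b∉Γ m = b∉Δ (dom-⊆ (λ m′ → ⊆Δ (there m′)) m)
    b≢a : ¬ b ≡ a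
    b≢a refl = b∉Δ (dom-∈ (⊆Δ (here refl)))
    F′ : Functional Sig ((b , χ) ∷ Γ)
    F′ = functional-∷ F b∉Γ
    a∉′ : a ∉ dom Sig ((b , χ) ∷ Γ)
    a∉′ (here a≡b) = b≢a (sym a≡b)
    a∉′ (there m)  = a∉ m
    E′ : Σ (((b , χ) ∷ Γ) ⊢s s ∶ φ) λ E″ → ⟦ E″ ⟧s ≡ ⟦ E ⟧s
    E′ = weaken there E

lemma3p5 : (Sig : Signature) → Signature.BaseTy Sig →
    (𝕌 : Universe) (M : Model Sig 𝕌) →
    ∀ (Γ : Env Sig) (a : Atom) (φ ψ : Type Sig) (r s : Term Sig) →
    Functional Sig Γ → a ∉ dom Sig Γ →
    (D : _⊢_∶_ Sig ((a , φ) ∷ Γ) r ψ) → (E : _⊢_∶_ Sig Γ s φ) →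
    ∀ (t : Term Sig) → _=α_ Sig t (subst Sig r a s) → (F : _⊢_∶_ Sig Γ t ψ) →
    ⟦_⟧ Sig 𝕌 M F ≡ Model.ap M (Model.abs M a φ (⟦_⟧ Sig 𝕌 M D)) (⟦_⟧ Sig 𝕌 M E)
lemma3p5 Sig _ 𝕌 M Γ a φ ψ r s FΓ a∉ D E t t=α F = begin
  ⟦ F ⟧⊢                               ≡⟨ sym (embed-⟦⟧ F) ⟩
  ⟦ embed F ⟧s                         ≡⟨ α-invariant FΓ t=α (embed F) (proj₁ substituted) ⟩
  ⟦ proj₁ substituted ⟧s               ≡⟨ proj₂ substituted ⟩
  ⟦ D ⟧⊢ [ a ∶ φ ↦ ⟦ embed E ⟧s ]      ≡⟨ cong (λ x → ⟦ D ⟧⊢ [ a ∶ φ ↦ x ]) (embed-⟦⟧ E) ⟩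
  ⟦ D ⟧⊢ [ a ∶ φ ↦ ⟦ E ⟧⊢ ]            ∎
  where
  open ≡-Reasoning
  open Semantics Sig 𝕌 M
  substituted : Σ (Γ ⊢s subst Sig r a s ∶ ψ) λ G → ⟦ G ⟧s ≡ ⟦ D ⟧⊢ [ a ∶ φ ↦ ⟦ embed E ⟧s ]
  substituted = substitution FΓ a∉ (λ m → m) (λ m → m) D (embed E)
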